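{- Let $p,m\ge 2$ be integers and let $P=\{321,\; p(p+1)12\cdots(p-1),\; (m+1)12\cdots m\}$. Then $P$ is a regular set of forbidden patterns, and its succession function is $$\chi_P(i,k)=\begin{cases} k+1 & \text{if } i=1 \text{ and } k<m,\\ m & \text{if } i=1 \text{ and } k=m,\\ i & \text{if } 1<i<p,\\ p-1 & \text{otherwise.}\end{cases}$$
   Context: A permutation contains a pattern $\sigma$ if some subsequence is order-isomorphic to $\sigma$; $S_n(P)$ is the set of permutations of $\{1,\dots,n\}$ avoiding all patterns in $P$ ($S_0(P)=\{\epsilon\}$), and $S(P)=\bigcup_n S_n(P)$. $P$ is right-justified if, for every $\alpha\in S(P)$, moving the largest entry one position to the right (when possible) gives a permutation in $S(P)$. A site of a permutation of length $n$ is one of the $n+1$ gaps (before the first entry, between consecutive entries, after the last entry); sites are numbered from right to left, so the site after the last entry is site $1$; the empty permutation has one site. For $\alpha\in S_n$, $\alpha^{\downarrow i}$ is obtained by inserting $n+1$ into site $i$ of $\alpha$. For $\alpha\in S_n(P)$, site $i$ is active if $\alpha^{\downarrow i}\in S_{n+1}(P)$. A right-justified set $P$ is regular if for every $\alpha\in S(P)$: site $1$ of $\alpha$ is active, and whenever $\alpha$ has $k$ active sites, for each $1\le i\le k$ the number of active sites of $\alpha^{\downarrow i}$ depends only on $i$ and $k$ (not on $\alpha$); this number is denoted $\chi_P(i,k)$, and $\chi_P$ is the succession function. (For right-justified $P$, the active sites of $\alpha$ are exactly $1,\dots,k$ for some $k$.) -}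

module Defs where

open import Data.Nat using (ℕ; zero; suc; _+_; _∸_; _≤_; _<_; _≡ᵇ_; _<ᵇ_)
open import Data.Bool using (if_then_else_)
open import Data.List using (List; []; _∷_; length; map; upTo; take; drop; _++_)
open import Data.List.Membership.Propositional using (_∈_)
open import Data.List.Relation.Unary.Unique.Propositional using (Unique)
open import Data.List.Relation.Binary.Sublist.Propositional using (_⊆_)
open import Data.List.Relation.Binary.Permutation.Propositional using (_↭_)
open import Data.Product using (_×_; ∃)
open import Function.Bundles using (_⇔_)
open import Relation.Binary.PropositionalEquality using (_≡_)
open import Relation.Nullary using (¬_)

-- Permutations are lists of natural numbers (one-line notation).

range : ℕ → List ℕ
range n = map suc (upTo n)

IsPerm : ℕ → List ℕ → Set
IsPerm n α = α ↭ range n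

-- i-th entry (0-based), default 0 outside the list
nth : List ℕ → ℕ → ℕ
nth []       _       = 0
nth (x ∷ xs) zero    = x
nth (x ∷ xs) (suc i) = nth xs i

OrdIso : List ℕ → List ℕ → Set
OrdIso xs ys = (length xs ≡ length ys) ×
  (∀ i j → i < length xs → j < length xs →
     (nth xs i < nth xs j) ⇔ (nth ys i < nth ys j))

Contains : List ℕ → List ℕ → Set
Contains α σ = ∃ λ τ → (τ ⊆ α) × OrdIso τ σ

Avoids : List (List ℕ) → List ℕ → Set
Avoids P α = ∀ σ → σ ∈ P → ¬ Contains α σ

InS : List (List ℕ) → ℕ → List ℕ → Set
InS P n α = IsPerm n α × Avoids P α

insertAt : ℕ → ℕ → List ℕ → List ℕ
insertAt k x α = take k α ++ (x ∷ drop k α)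

-- α^{↓i}: insert n+1 into site i of α (sites numbered right to left,
-- site 1 is after the last entry, site n+1 before the first)
ins : List ℕ → ℕ → List ℕ
ins α i = insertAt (suc (length α) ∸ i) (suc (length α)) α

Active : List (List ℕ) → List ℕ → ℕ → Set
Active P α i = (1 ≤ i) × (i ≤ suc (length α)) × Avoids P (ins α i)

NumActive : List (List ℕ) → List ℕ → ℕ → Set
NumActive P α k = ∃ λ (L : List ℕ) →
  Unique L × (length L ≡ k) × (∀ i → (i ∈ L) ⇔ Active P α i)

swapAt : ℕ → List ℕ → List ℕ
swapAt zero    (x ∷ y ∷ xs) = y ∷ x ∷ xs
swapAt zero    xs           = xs
swapAt (suc k) []           = []
swapAt (suc k) (x ∷ xs)     = x ∷ swapAt k xs

RightJustified : List (List ℕ) → Set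
RightJustified P = ∀ n α k → InS P n α → nth α k ≡ n → suc k < n →
  InS P n (swapAt k α)

IsRegularWith : List (List ℕ) → (ℕ → ℕ → ℕ) → Set
IsRegularWith P χ = RightJustified P ×
  (∀ n α → InS P n α → Active P α 1) ×
  (∀ n α k i → InS P n α → NumActive P α k → 1 ≤ i → i ≤ k →
     NumActive P (ins α i) (χ i k))

Regular : List (List ℕ) → Set
Regular P = ∃ λ χ → IsRegularWith P χ

patterns : ℕ → ℕ → List (List ℕ)
patterns p m = (3 ∷ 2 ∷ 1 ∷ []) ∷ (p ∷ suc p ∷ range (p ∸ 1)) ∷ (suc m ∷ range m) ∷ []

chi : ℕ → ℕ → ℕ → ℕ → ℕ
chi p m i k =
  if i ≡ᵇ 1
  then (if k <ᵇ m then suc k else (if k ≡ᵇ m then m else p ∸ 1))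
  else (if i <ᵇ p then i else p ∸ 1)

module Submission where

-- Write α ∈ S(P) as A ++ B with |B| = i − 1 and let N = |α| + 1.  An occurrence of a pattern
-- of P in A ++ N ∷ B that uses N must use it as the pattern's largest entry, so site i of α is
-- active exactly when B is increasing (no 321), |B| < m (no (m+1)12⋯m), and every entry of A
-- lies above fewer than p − 1 entries of B (no p(p+1)12⋯(p−1)).  These conditions are
-- decidable and survive moving the first entry of B into A, so the active sites are 1, …, k
-- for some k ≤ m.  Moving the maximum one step to the right is exactly such a move, which
-- gives right-justification.  After inserting N at site 1, site j + 1 of the new permutation
-- is active iff site j of α is active and j < m: min(k + 1, m) active sites.  After inserting
-- N at site i ≥ 2, the suffixes of length < i lie after N and are admissible iff they are
-- shorter than p − 1, while longer ones start with N followed by a smaller entry: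
-- min(i, p − 1) active sites.

open import Defs
open import Data.Bool using (true; false)
open import Data.Empty using (⊥; ⊥-elim)
open import Data.Nat
open import Data.Nat.Properties
open import Data.Product using (_×_; _,_; proj₁; proj₂; ∃; ∃₂)
open import Data.Product.Function.NonDependent.Propositional using (_×-⇔_)
open import Data.Sum using (_⊎_; inj₁; inj₂)
open import Data.Unit using (⊤; tt)
open import Data.List using (List; []; _∷_; [_]; length; upTo; take; drop; filter; _++_)
open import Data.List.Properties
  using ( length-++; length-++-sucʳ; ++-assoc; ++-identityʳ; length-map; length-upTo; length-take; length-drop
        ; take++drop≡id; filter-all; filter-none; filter-++; filter-reject; length-filter)
open import Data.List.Membership.Propositional using (_∈_; _∉_)
open import Data.List.Membership.Propositional.Properties using (∈-map⁺; ∈-map⁻; ∈-upTo⁺; ∈-upTo⁻; ∈-++⁺ʳ)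
open import Data.List.Membership.Propositional.Properties.WithK using (unique∧set⇒bag)
open import Data.List.Relation.Binary.BagAndSetEquality using (∼bag⇒↭)
open import Data.List.Relation.Unary.Any using (here; there)
open import Data.List.Relation.Unary.All as All using (All; []; _∷_)
import Data.List.Relation.Unary.All.Properties as All
open import Data.List.Relation.Unary.AllPairs as AllPairs using (AllPairs; []; _∷_)
import Data.List.Relation.Unary.AllPairs.Properties as AllPairs
open import Data.List.Relation.Unary.Unique.Propositional using (Unique)
open import Data.List.Relation.Binary.Sublist.Propositional
  using (_⊆_; []; _∷_; _∷ʳ_; ⊆-refl; ⊆-trans; minimum; to∈; from∈)
open import Data.List.Relation.Binary.Sublist.Propositional.Properties
  using (All-resp-⊆; length-mono-≤; filter⁺; take-⊆; filter-⊆)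
  renaming (++⁺ to ⊆-++⁺; ++⁺ˡ to ⊆-++⁺ˡ; ++⁺ʳ to ⊆-++⁺ʳ)
import Data.List.Relation.Binary.Permutation.Propositional as ↭
open ↭ using (↭⇒↭ₛ)
open import Data.List.Relation.Binary.Permutation.Propositional.Properties using (↭-length; All-resp-↭; shift; ++⁺ˡ)
open import Function.Base using (_∘_)
open import Function.Bundles using (_⇔_; mk⇔; Equivalence)
import Function.Properties.Equivalence as ⇔
open import Level using (Level)
open import Relation.Binary.Definitions using (tri<; tri≈; tri>)
open import Relation.Binary.PropositionalEquality using (_≡_; _≢_; refl; sym; trans; cong; subst; setoid)
open import Data.List.Relation.Binary.Permutation.Setoid.Properties (setoid ℕ) using (Unique-resp-↭)
open import Relation.Nullary using (¬_; Dec; yes; no)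
open import Relation.Nullary.Reflects using (ofʸ; ofⁿ)
import Relation.Nullary.Decidable as Dec
open import Relation.Nullary.Decidable using (_×-dec_)

open Equivalence using (to; from)

private
  variable
    a : Level
    X : Set a

⇔-⊥ : {A B : Set} → ¬ A → ¬ B → A ⇔ B
⇔-⊥ ¬a ¬b = mk⇔ (λ a → ⊥-elim (¬a a)) (λ b → ⊥-elim (¬b b))

⇔-⊤ : {A B : Set} → A → B → A ⇔ B
⇔-⊤ a b = mk⇔ (λ _ → b) (λ _ → a)

AllPairs-resp-⊆ : ∀ {R : X → X → Set} {xs ys} → xs ⊆ ys → AllPairs R ys → AllPairs R xs
AllPairs-resp-⊆ []           []         = []
AllPairs-resp-⊆ (_ ∷ʳ xs⊆)   (_ ∷ rys)  = AllPairs-resp-⊆ xs⊆ rys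
AllPairs-resp-⊆ (refl ∷ xs⊆) (ry ∷ rys) = All-resp-⊆ xs⊆ ry ∷ AllPairs-resp-⊆ xs⊆ rys

⊆-middle⁻ : ∀ (A : List X) {x B τ} → τ ⊆ A ++ x ∷ B →
  τ ⊆ A ++ B ⊎ ∃₂ λ τ₁ τ₂ → τ ≡ τ₁ ++ x ∷ τ₂ × τ₁ ⊆ A × τ₂ ⊆ B
⊆-middle⁻ []      (_ ∷ʳ τ⊆)   = inj₁ τ⊆
⊆-middle⁻ []      (refl ∷ τ⊆) = inj₂ ([] , _ , refl , [] , τ⊆)
⊆-middle⁻ (a ∷ A) (_ ∷ʳ τ⊆) with ⊆-middle⁻ A τ⊆
... | inj₁ τ⊆′                        = inj₁ (a ∷ʳ τ⊆′)
... | inj₂ (τ₁ , τ₂ , refl , τ₁⊆ , τ₂⊆) = inj₂ (τ₁ , τ₂ , refl , a ∷ʳ τ₁⊆ , τ₂⊆)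
⊆-middle⁻ (a ∷ A) (refl ∷ τ⊆) with ⊆-middle⁻ A τ⊆
... | inj₁ τ⊆′                        = inj₁ (refl ∷ τ⊆′)
... | inj₂ (τ₁ , τ₂ , refl , τ₁⊆ , τ₂⊆) = inj₂ (a ∷ τ₁ , τ₂ , refl , refl ∷ τ₁⊆ , τ₂⊆)

suffixOfLength : ∀ (xs : List X) j → j ≤ length xs → ∃₂ λ A B → xs ≡ A ++ B × length B ≡ j
suffixOfLength xs j j≤ = take k xs , drop k xs , sym (take++drop≡id k xs) , trans (length-drop k xs) (m∸[m∸n]≡n j≤)
  where k = length xs ∸ j

insertAt-++ : ∀ (A B : List ℕ) x → insertAt (length A) x (A ++ B) ≡ A ++ x ∷ B
insertAt-++ []      B x = refl
insertAt-++ (a ∷ A) B x = cong (a ∷_) (insertAt-++ A B x)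

ins-++ : ∀ A B → ins (A ++ B) (suc (length B)) ≡ A ++ suc (length (A ++ B)) ∷ B
ins-++ A B = trans (cong (λ k → insertAt k (suc (length (A ++ B))) (A ++ B)) |A|) (insertAt-++ A B _)
  where
  |A| : length (A ++ B) ∸ length B ≡ length A
  |A| = trans (cong (_∸ length B) (length-++ A)) (m+n∸n≡m (length A) (length B))

swapAt-decomposition : ∀ (xs : List ℕ) k → suc k < length xs →
  ∃₂ λ A B → ∃₂ λ z y → xs ≡ A ++ z ∷ y ∷ B × nth xs k ≡ z × swapAt k xs ≡ A ++ y ∷ z ∷ B
swapAt-decomposition (z ∷ y ∷ B) zero    _ = [] , B , z , y , refl , refl , refl
swapAt-decomposition (x ∷ xs)    (suc k) (s≤s k<) with swapAt-decomposition xs k k<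
... | A , B , z , y , refl , nth≡ , swap≡ = x ∷ A , B , z , y , refl , nth≡ , cong (x ∷_) swap≡

↓-closed⇒≤-closed : ∀ {Q : ℕ → Set} → (∀ j → Q (suc j) → Q j) → ∀ {j k} → j ≤ k → Q k → Q j
↓-closed⇒≤-closed {Q} ↓ {j} {k} j≤k q with m≤n⇒m<n∨m≡n j≤k
... | inj₂ refl = q
... | inj₁ (s≤s j≤k′) = ↓-closed⇒≤-closed ↓ j≤k′ (↓ _ q)

↓-closed⇒initialSegment : ∀ {Q : ℕ → Set} → (∀ j → Dec (Q j)) → (∀ j → Q (suc j) → Q j) →
  ∀ b → (∀ j → Q j → j < b) → ∃ λ K → ∀ j → Q j ⇔ j < K
↓-closed⇒initialSegment Q? ↓ zero    bounded = 0 , λ j → ⇔-⊥ (λ q → n≮0 (bounded j q)) n≮0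
↓-closed⇒initialSegment Q? ↓ (suc b) bounded with Q? b
... | yes qb = suc b , λ j → mk⇔ (bounded j) (λ j<1+b → ↓-closed⇒≤-closed ↓ (≤-pred j<1+b) qb)
... | no ¬qb = ↓-closed⇒initialSegment Q? ↓ b
                 (λ j q → ≤∧≢⇒< (≤-pred (bounded j q)) (λ { refl → ¬qb q }))

length-range : ∀ n → length (range n) ≡ n
length-range n = trans (length-map suc (upTo n)) (length-upTo n)

range-increasing : ∀ n → AllPairs _<_ (range n)
range-increasing n = AllPairs.map⁺ (AllPairs.applyUpTo⁺₁ (λ x → x) n (λ i<j _ → s≤s i<j))

suc∈range⇔ : ∀ {n j} → suc j ∈ range n ⇔ j < n
suc∈range⇔ {n} {j} = mk⇔ from-range (λ j<n → ∈-map⁺ suc (∈-upTo⁺ j<n))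
  where
  from-range : suc j ∈ range n → j < n
  from-range j∈ with ∈-map⁻ suc j∈
  ... | _ , i∈ , refl = ∈-upTo⁻ i∈

0∉range : ∀ {n} → 0 ∉ range n
0∉range 0∈ with ∈-map⁻ suc 0∈
... | _ , _ , ()

range-bounded : ∀ n → All (_≤ n) (range n)
range-bounded n = All.tabulate λ {x} x∈ → bound x x∈
  where
  bound : ∀ x → x ∈ range n → x ≤ n
  bound zero    0∈ = ⊥-elim (0∉range 0∈)
  bound (suc x) x∈ = to suc∈range⇔ x∈

All-nth : ∀ {P : ℕ → Set} {xs j} → All P xs → j < length xs → P (nth xs j)
All-nth {j = zero}  (px ∷ _)   _        = px
All-nth {j = suc j} (_ ∷ pxs) (s≤s j<) = All-nth pxs j<

nth-All : ∀ {P : ℕ → Set} xs → (∀ j → j < length xs → P (nth xs j)) → All P xs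
nth-All []       _    = []
nth-All (x ∷ xs) pnth = pnth 0 z<s ∷ nth-All xs (λ j j< → pnth (suc j) (s≤s j<))

AllPairs-nth : ∀ {R : ℕ → ℕ → Set} {xs i j} → AllPairs R xs → i < j → j < length xs → R (nth xs i) (nth xs j)
AllPairs-nth {i = zero}  {suc j} (rx ∷ _)   _         (s≤s j<) = All-nth rx j<
AllPairs-nth {i = suc i} {suc j} (_ ∷ rxs) (s≤s i<j) (s≤s j<) = AllPairs-nth rxs i<j j<

nth-middle : ∀ (τ₁ : List ℕ) {x τ₂} → nth (τ₁ ++ x ∷ τ₂) (length τ₁) ≡ x
nth-middle []       = refl
nth-middle (_ ∷ τ₁) = nth-middle τ₁

nth-offMiddle : ∀ {x} τ₁ {τ₂} → All (_< x) (τ₁ ++ τ₂) → ∀ j → j < length (τ₁ ++ x ∷ τ₂) → j ≢ length τ₁ →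
  nth (τ₁ ++ x ∷ τ₂) j < x
nth-offMiddle []       τ₂<x     zero    _        j≢ = ⊥-elim (j≢ refl)
nth-offMiddle []       τ₂<x     (suc j) (s≤s j<) _  = All-nth τ₂<x j<
nth-offMiddle (_ ∷ τ₁) (y<x ∷ _) zero   _        _  = y<x
nth-offMiddle (_ ∷ τ₁) (_ ∷ τ<x) (suc j) (s≤s j<) j≢ = nth-offMiddle τ₁ τ<x j j< (λ { refl → j≢ refl })

ComparesAs : (ℕ → ℕ → Set) → List ℕ → Set
ComparesAs R xs = ∀ i j → i < length xs → j < length xs → (nth xs i < nth xs j ⇔ R i j)

ordIso-via : ∀ {R xs ys} → length xs ≡ length ys → ComparesAs R xs → ComparesAs R ys → OrdIso xs ys
ordIso-via {xs = xs} |xs|≡ cmp-xs cmp-ys = |xs|≡ , λ i j i< j< →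
  ⇔.trans (cmp-xs i j i< j<) (⇔.sym (cmp-ys i j (subst (i <_) |xs|≡ i<) (subst (j <_) |xs|≡ j<)))

increasing-comparesAs : ∀ {xs} → AllPairs _<_ xs → ComparesAs _<_ xs
increasing-comparesAs inc i j i< j< = mk⇔ reflect (λ i<j → AllPairs-nth inc i<j j<)
  where
  reflect : _ → i < j
  reflect lt with <-cmp i j
  ... | tri< i<j _ _ = i<j
  ... | tri≈ _ refl _ = ⊥-elim (<-irrefl refl lt)
  ... | tri> _ _ j<i = ⊥-elim (<-asym lt (AllPairs-nth inc j<i i<))

decreasing-comparesAs : ∀ {xs} → AllPairs _>_ xs → ComparesAs _>_ xs
decreasing-comparesAs dec i j i< j< = mk⇔ reflect (λ j<i → AllPairs-nth dec j<i i<)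
  where
  reflect : _ → j < i
  reflect lt with <-cmp i j
  ... | tri< i<j _ _ = ⊥-elim (<-asym lt (AllPairs-nth dec i<j j<))
  ... | tri≈ _ refl _ = ⊥-elim (<-irrefl refl lt)
  ... | tri> _ _ j<i = j<i

MaxFirst : (ℕ → ℕ → Set) → ℕ → ℕ → Set
MaxFirst R zero    _       = ⊥
MaxFirst R (suc i) zero    = ⊤
MaxFirst R (suc i) (suc j) = R i j

maxFirst-comparesAs : ∀ {R x xs} → All (_< x) xs → ComparesAs R xs → ComparesAs (MaxFirst R) (x ∷ xs)
maxFirst-comparesAs xs<x cmp zero    zero    _        _        = ⇔-⊥ (<-irrefl refl) λ ()
maxFirst-comparesAs xs<x cmp zero    (suc j) _        (s≤s j<) = ⇔-⊥ (<-asym (All-nth xs<x j<)) λ ()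
maxFirst-comparesAs xs<x cmp (suc i) zero    (s≤s i<) _        = ⇔-⊤ (All-nth xs<x i<) tt
maxFirst-comparesAs xs<x cmp (suc i) (suc j) (s≤s i<) (s≤s j<) = cmp i j i< j<

SecondMaxFirst : (ℕ → ℕ → Set) → ℕ → ℕ → Set
SecondMaxFirst R zero          (suc zero)    = ⊤
SecondMaxFirst R zero          _             = ⊥
SecondMaxFirst R (suc zero)    _             = ⊥
SecondMaxFirst R (suc (suc i)) zero          = ⊤
SecondMaxFirst R (suc (suc i)) (suc zero)    = ⊤
SecondMaxFirst R (suc (suc i)) (suc (suc j)) = R i j

secondMaxFirst-comparesAs : ∀ {R x y xs} → x < y → All (_< x) xs → ComparesAs R xs →
  ComparesAs (SecondMaxFirst R) (x ∷ y ∷ xs)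
secondMaxFirst-comparesAs x<y xs<x cmp = λ where
  zero          zero          _              _              → ⇔-⊥ (<-irrefl refl) λ ()
  zero          (suc zero)    _              _              → ⇔-⊤ x<y tt
  zero          (suc (suc j)) _              (s≤s (s≤s j<)) → ⇔-⊥ (<-asym (All-nth xs<x j<)) λ ()
  (suc zero)    zero          _              _              → ⇔-⊥ (<-asym x<y) λ ()
  (suc zero)    (suc zero)    _              _              → ⇔-⊥ (<-irrefl refl) λ ()
  (suc zero)    (suc (suc j)) _              (s≤s (s≤s j<)) → ⇔-⊥ (<-asym (<-trans (All-nth xs<x j<) x<y)) λ ()
  (suc (suc i)) zero          (s≤s (s≤s i<)) _              → ⇔-⊤ (All-nth xs<x i<) tt
  (suc (suc i)) (suc zero)    (s≤s (s≤s i<)) _              → ⇔-⊤ (<-trans (All-nth xs<x i<) x<y) tt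
  (suc (suc i)) (suc (suc j)) (s≤s (s≤s i<)) (s≤s (s≤s j<)) → cmp i j i< j<

ordIso-argmax : ∀ {τ σ q r} → OrdIso τ σ → q < length τ →
  (∀ j → j < length τ → j ≢ q → nth τ j < nth τ q) → r < length σ → All (_≤ nth σ r) σ → q ≡ r
ordIso-argmax {q = q} {r} (|τ|≡ , iso) q< τ-max r< σ≤ with q ≟ r
... | yes q≡r = q≡r
... | no  q≢r = ⊥-elim (≤⇒≯ (All-nth σ≤ (subst (q <_) |τ|≡ q<)) (to (iso r q r<′ q<) (τ-max r r<′ (q≢r ∘ sym))))
  where r<′ = subst (r <_) (sym |τ|≡) r<

middle-position : ∀ {x σ r} τ₁ τ₂ → All (_< x) (τ₁ ++ τ₂) → OrdIso (τ₁ ++ x ∷ τ₂) σ →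
  r < length σ → All (_≤ nth σ r) σ → length τ₁ ≡ r
middle-position {x} τ₁ τ₂ τ<x iso = ordIso-argmax {τ = τ₁ ++ x ∷ τ₂} iso (|τ₁|< τ₁) x-max
  where
  |τ₁|< : ∀ τ₁ → length τ₁ < length (τ₁ ++ x ∷ τ₂)
  |τ₁|< []       = z<s
  |τ₁|< (_ ∷ τ₁) = s≤s (|τ₁|< τ₁)

  x-max : ∀ j → j < length (τ₁ ++ x ∷ τ₂) → j ≢ length τ₁ → nth (τ₁ ++ x ∷ τ₂) j < nth (τ₁ ++ x ∷ τ₂) (length τ₁)
  x-max j j< j≢ rewrite nth-middle τ₁ {x} {τ₂} = nth-offMiddle τ₁ τ<x j j< j≢

unique-max⇒others< : ∀ A {x} B → Unique (A ++ x ∷ B) → All (_≤ x) (A ++ x ∷ B) → All (_< x) (A ++ B)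
unique-max⇒others< A {x} B u ≤x =
  All.zipWith (λ { (y≤x , x≢y) → ≤∧≢⇒< y≤x (x≢y ∘ sym) })
    (All-resp-⊆ (⊆-++⁺ ⊆-refl (x ∷ʳ ⊆-refl)) ≤x , AllPairs.head (Unique-resp-↭ (↭⇒↭ₛ (shift x A B)) u))

<-⊓⇔ : ∀ {j a b} → j < a ⊓ b ⇔ (j < a × j < b)
<-⊓⇔ {a = a} {b} = mk⇔ (λ j< → m<n⊓o⇒m<n a b j< , m<n⊓o⇒m<o a b j<) (λ { (j<a , j<b) → ⊓-glb j<a j<b })

s<s⇔ : ∀ {j k} → j < k ⇔ suc j < suc k
s<s⇔ = mk⇔ s≤s ≤-pred

length-∷ʳ : ∀ (xs : List X) x → length (xs ++ [ x ]) ≡ suc (length xs)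
length-∷ʳ xs x = trans (length-++ xs) (+-comm (length xs) 1)

ins-site1 : ∀ α → ins α 1 ≡ α ++ [ suc (length α) ]
ins-site1 α = trans (cong (insertAt (length α) _) (sym (++-identityʳ α))) (insertAt-++ α [] _)

ActiveUpTo : List (List ℕ) → List ℕ → ℕ → Set
ActiveUpTo P α K = ∀ j → Active P α (suc j) ⇔ j < K

numActive-unique : ∀ {P α k k′} → NumActive P α k → NumActive P α k′ → k ≡ k′
numActive-unique (L , uL , refl , L⇔) (L′ , uL′ , refl , L′⇔) =
  ↭-length (∼bag⇒↭ (unique∧set⇒bag uL uL′ λ {i} → ⇔.trans (L⇔ i) (⇔.sym (L′⇔ i))))

activeUpTo⇒numActive : ∀ {P α K} → ActiveUpTo P α K → NumActive P α K
activeUpTo⇒numActive {P} {α} {K} act =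
  range K , AllPairs.map <⇒≢ (range-increasing K) , length-range K , range⇔active
  where
  range⇔active : ∀ i → i ∈ range K ⇔ Active P α i
  range⇔active zero    = ⇔-⊥ 0∉range λ { (() , _) }
  range⇔active (suc j) = ⇔.trans suc∈range⇔ (⇔.sym (act j))

Avoids-resp-⊆ : ∀ {P α β} → α ⊆ β → Avoids P β → Avoids P α
Avoids-resp-⊆ α⊆β β-avoids σ σ∈P (τ , τ⊆α , iso) = β-avoids σ σ∈P (τ , ⊆-trans τ⊆α α⊆β , iso)

module Regularity (p m : ℕ) (2≤p : 2 ≤ p) (2≤m : 2 ≤ m) where

  P : List (List ℕ)
  P = patterns p m

  p∸1<p : p ∸ 1 < p
  p∸1<p = ∸-monoʳ-< z<s (<⇒≤ 2≤p)

  0<p∸1 : 0 < p ∸ 1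
  0<p∸1 = m<n⇒0<n∸m 2≤p

  below : ℕ → List ℕ → List ℕ
  below x = filter (_<? x)

  below-mono : ∀ {x τ B} → τ ⊆ B → below x τ ⊆ below x B
  below-mono {x} = filter⁺ (_<? x) (_<? x) λ { refl y<x → y<x }

  ⊆-below : ∀ {x τ B} → τ ⊆ B → All (_< x) τ → τ ⊆ below x B
  ⊆-below {x} {B = B} τ⊆ τ<x = subst (_⊆ below x B) (filter-all (_<? x) τ<x) (below-mono τ⊆)

  below-∷ʳ-larger : ∀ {x N} C → x < N → below x (C ++ [ N ]) ≡ below x C
  below-∷ʳ-larger {x} C x<N =
    trans (filter-++ (_<? x) C _) (trans (cong (below x C ++_) (filter-reject (_<? x) (<-asym x<N))) (++-identityʳ _))

  FewBelow : List ℕ → ℕ → Set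
  FewBelow B x = length (below x B) < p ∸ 1

  Admissible : List ℕ → List ℕ → Set
  Admissible A B = AllPairs _<_ B × length B < m × All (FewBelow B) A

  no321-through : ∀ {N B} τ₁ τ₂ → τ₂ ⊆ B → AllPairs _<_ B → All (_< N) (τ₁ ++ τ₂) →
    ¬ OrdIso (τ₁ ++ N ∷ τ₂) (3 ∷ 2 ∷ 1 ∷ [])
  no321-through τ₁ τ₂ τ₂⊆ inc τ<N iso
    with middle-position τ₁ τ₂ τ<N iso z<s (≤-refl ∷ s≤s (s≤s z≤n) ∷ s≤s z≤n ∷ [])
  no321-through [] (_ ∷ _ ∷ []) τ₂⊆ inc _ (_ , iso) | refl with AllPairs-resp-⊆ τ₂⊆ inc
  ... | (a<b ∷ []) ∷ _ = <-asym (to (iso 1 2 (s≤s (s≤s z≤n)) (s≤s (s≤s (s≤s z≤n)))) a<b) (s≤s (s≤s z≤n))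

  noRun-through : ∀ {N B} τ₁ τ₂ → τ₂ ⊆ B → length B < m → All (_< N) (τ₁ ++ τ₂) →
    ¬ OrdIso (τ₁ ++ N ∷ τ₂) (suc m ∷ range m)
  noRun-through τ₁ τ₂ τ₂⊆ short τ<N iso
    with middle-position τ₁ τ₂ τ<N iso z<s (≤-refl ∷ All.map m≤n⇒m≤1+n (range-bounded m))
  noRun-through [] τ₂ τ₂⊆ short _ (|τ|≡ , _) | refl =
    <⇒≱ short (subst (_≤ _) (trans (suc-injective |τ|≡) (length-range m)) (length-mono-≤ τ₂⊆))

  noRunBelow-through : ∀ {N A B} τ₁ τ₂ → τ₁ ⊆ A → τ₂ ⊆ B → All (FewBelow B) A →
    All (_< N) (τ₁ ++ τ₂) → ¬ OrdIso (τ₁ ++ N ∷ τ₂) (p ∷ suc p ∷ range (p ∸ 1))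
  noRunBelow-through τ₁ τ₂ τ₁⊆ τ₂⊆ few τ<N iso
    with middle-position τ₁ τ₂ τ<N iso (s≤s z<s) (n≤1+n p ∷ ≤-refl ∷ All.map (λ x≤ → ≤-trans x≤ (m≤n⇒m≤1+n (m∸n≤m p 1))) (range-bounded (p ∸ 1)))
  noRunBelow-through {B = B} (x ∷ []) τ₂ x⊆ τ₂⊆ few _ (|τ|≡ , iso) | refl =
    <⇒≱ (All.lookup few (to∈ x⊆)) (subst (_≤ _) |τ₂|≡ (length-mono-≤ (⊆-below τ₂⊆ τ₂<x)))
    where
    |τ₂|≡ : length τ₂ ≡ p ∸ 1
    |τ₂|≡ = trans (suc-injective (suc-injective |τ|≡)) (length-range (p ∸ 1))

    τ₂<x : All (_< x) τ₂
    τ₂<x = nth-All τ₂ λ j j< → from (iso (2 + j) 0 (s≤s (s≤s j<)) z<s)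
      (≤-<-trans (All-nth (range-bounded (p ∸ 1)) (subst (j <_) (trans |τ₂|≡ (sym (length-range (p ∸ 1)))) j<))
                 p∸1<p)

  admissible⇒avoids : ∀ {N} A B → Avoids P (A ++ B) → All (_< N) (A ++ B) → Admissible A B →
    Avoids P (A ++ N ∷ B)
  admissible⇒avoids {N} A B avoids <N (inc , short , few) σ σ∈P (τ , τ⊆ , iso) with ⊆-middle⁻ A τ⊆
  ... | inj₁ τ⊆′                          = avoids σ σ∈P (τ , τ⊆′ , iso)
  ... | inj₂ (τ₁ , τ₂ , refl , τ₁⊆ , τ₂⊆) = through σ∈P iso
    where
    τ<N : All (_< N) (τ₁ ++ τ₂)
    τ<N = All-resp-⊆ (⊆-++⁺ τ₁⊆ τ₂⊆) <N

    through : ∀ {σ} → σ ∈ P → ¬ OrdIso (τ₁ ++ N ∷ τ₂) σ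
    through (here refl)                 = no321-through τ₁ τ₂ τ₂⊆ inc τ<N
    through (there (here refl))         = noRunBelow-through τ₁ τ₂ τ₁⊆ τ₂⊆ few τ<N
    through (there (there (here refl))) = noRun-through τ₁ τ₂ τ₂⊆ short τ<N

  avoids⇒increasing : ∀ {N} A B → Avoids P (A ++ N ∷ B) → All (_< N) B → Unique B → AllPairs _<_ B
  avoids⇒increasing A []            _      _            _              = []
  avoids⇒increasing A (_ ∷ [])      _      _            _              = [] ∷ []
  avoids⇒increasing {N} A (b₁ ∷ b₂ ∷ B) avoids (b₁<N ∷ B<N) ((b₁≢b₂ ∷ _) ∷ uB)
    with avoids⇒increasing A (b₂ ∷ B) (Avoids-resp-⊆ (⊆-++⁺ ⊆-refl (refl ∷ b₁ ∷ʳ ⊆-refl)) avoids) B<N uB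
  ... | inc@(b₂< ∷ _) with b₁ <? b₂
  ...   | yes b₁<b₂ = (b₁<b₂ ∷ All.map (<-trans b₁<b₂) b₂<) ∷ inc
  ...   | no  b₁≮b₂ = ⊥-elim (avoids _ (here refl)
          (N ∷ b₁ ∷ b₂ ∷ [] , ⊆-++⁺ˡ A (refl ∷ refl ∷ refl ∷ minimum B) ,
           ordIso-via refl (decreasing-comparesAs Nb₁b₂-decreasing) (decreasing-comparesAs 321-decreasing)))
    where
    Nb₁b₂-decreasing : AllPairs _>_ (N ∷ b₁ ∷ b₂ ∷ [])
    Nb₁b₂-decreasing = (b₁<N ∷ All.head B<N ∷ []) ∷ (≤∧≢⇒< (≮⇒≥ b₁≮b₂) (b₁≢b₂ ∘ sym) ∷ []) ∷ [] ∷ []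

    321-decreasing : AllPairs _>_ (3 ∷ 2 ∷ 1 ∷ [])
    321-decreasing = (s<s (s<s z<s) ∷ s<s z<s ∷ []) ∷ (s<s z<s ∷ []) ∷ [] ∷ []

  avoids⇒short : ∀ {N} A B → Avoids P (A ++ N ∷ B) → All (_< N) B → AllPairs _<_ B → length B < m
  avoids⇒short {N} A B avoids B<N inc with length B <? m
  ... | yes short = short
  ... | no ¬short = ⊥-elim (avoids _ (there (there (here refl)))
        (N ∷ take m B , ⊆-++⁺ˡ A (refl ∷ take-⊆ m B) ,
         ordIso-via |NT|≡
           (maxFirst-comparesAs (All-resp-⊆ (take-⊆ m B) B<N) (increasing-comparesAs (AllPairs.take⁺ m inc)))
           (maxFirst-comparesAs (All.map s≤s (range-bounded m)) (increasing-comparesAs (range-increasing m)))))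
    where
    |NT|≡ : length (N ∷ take m B) ≡ length (suc m ∷ range m)
    |NT|≡ = cong suc (trans (length-take m B) (trans (m≤n⇒m⊓n≡m (≮⇒≥ ¬short)) (sym (length-range m))))

  avoids⇒fewBelow : ∀ {N} A B → Avoids P (A ++ N ∷ B) → All (_< N) A → AllPairs _<_ B → All (FewBelow B) A
  avoids⇒fewBelow {N} A B avoids A<N inc = All.tabulate few
    where
    few : ∀ {x} → x ∈ A → FewBelow B x
    few {x} x∈A with length (below x B) <? p ∸ 1
    ... | yes few = few
    ... | no ¬few = ⊥-elim (avoids _ (there (here refl))
          (x ∷ N ∷ run , ⊆-++⁺ (from∈ x∈A) (refl ∷ ⊆-trans (take-⊆ _ _) (filter-⊆ (_<? x) B)) ,
           ordIso-via |xNT|≡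
             (secondMaxFirst-comparesAs (All.lookup A<N x∈A) (All-resp-⊆ (take-⊆ _ _) (All.all-filter (_<? x) B))
               (increasing-comparesAs (AllPairs.take⁺ (p ∸ 1) (AllPairs.filter⁺ (_<? x) inc))))
             (secondMaxFirst-comparesAs (n<1+n p) (All.map (λ y≤ → ≤-<-trans y≤ p∸1<p) (range-bounded (p ∸ 1)))
               (increasing-comparesAs (range-increasing (p ∸ 1))))))
      where
      run = take (p ∸ 1) (below x B)

      |xNT|≡ : length (x ∷ N ∷ run) ≡ length (p ∷ suc p ∷ range (p ∸ 1))
      |xNT|≡ = cong (2 +_) (trans (length-take (p ∸ 1) (below x B))
                 (trans (m≤n⇒m⊓n≡m (≮⇒≥ ¬few)) (sym (length-range (p ∸ 1)))))

  avoids⇒admissible : ∀ {N} A B → Avoids P (A ++ N ∷ B) → All (_< N) (A ++ B) → Unique B → Admissible A B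
  avoids⇒admissible A B avoids <N uB = inc , avoids⇒short A B avoids B<N inc , avoids⇒fewBelow A B avoids (All.++⁻ˡ A <N) inc
    where
    B<N = All.++⁻ʳ A <N
    inc = avoids⇒increasing A B avoids B<N uB

  admissible? : ∀ A B → Dec (Admissible A B)
  admissible? A B =
    AllPairs.allPairs? _<?_ B ×-dec length B <? m ×-dec All.all? (λ x → length (below x B) <? p ∸ 1) A

  admissible-[] : ∀ A → Admissible A []
  admissible-[] A = [] , <-≤-trans z<s 2≤m , All.universal (λ _ → 0<p∸1) A

  admissible-shift : ∀ A y B → Admissible A (y ∷ B) → Admissible (A ++ [ y ]) B
  admissible-shift A y B ((y< ∷ inc) , short , few) =
    inc , <-trans (n<1+n _) short ,
    All.++⁺ (All.map (λ {x} → ≤-<-trans (length-mono-≤ (below-mono {x} (y ∷ʳ ⊆-refl)))) few)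
            (subst (λ ys → length ys < p ∸ 1) (sym (filter-none (_<? y) (All.map <⇒≯ y<))) 0<p∸1 ∷ [])

  admissible-∷ʳ : ∀ {N} A C → All (_< N) A → All (_< N) C →
    Admissible A (C ++ [ N ]) ⇔ (Admissible A C × suc (length C) < m)
  admissible-∷ʳ {N} A C A<N C<N = mk⇔
    (λ { (inc , short , few) →
         (AllPairs-resp-⊆ (⊆-++⁺ʳ [ N ] ⊆-refl) inc , <-trans (n<1+n _) (short′ short) ,
          All.zipWith (λ (x<N , few) → subst (λ ys → length ys < p ∸ 1) (below-∷ʳ-larger C x<N) few) (A<N , few)) ,
         short′ short })
    (λ { ((inc , _ , few) , short) →
         AllPairs.++⁺ inc ([] ∷ []) (All.map (_∷ []) C<N) , subst (_< m) (sym |C∷ʳN|) short ,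
         All.zipWith (λ (x<N , few) → subst (λ ys → length ys < p ∸ 1) (sym (below-∷ʳ-larger C x<N)) few) (A<N , few) })
    where
    |C∷ʳN| = length-∷ʳ C N

    short′ : length (C ++ [ N ]) < m → suc (length C) < m
    short′ = subst (_< m) |C∷ʳN|

  admissible-afterMax : ∀ {N} A B₁ B₂ → AllPairs _<_ B₂ → length B₂ < m → All (_< N) B₂ →
    Admissible (A ++ N ∷ B₁) B₂ ⇔ length B₂ < p ∸ 1
  admissible-afterMax {N} A B₁ B₂ inc short B₂<N = mk⇔
    (λ { (_ , _ , few) → subst (λ ys → length ys < p ∸ 1) (filter-all (_<? N) B₂<N) (All.lookup few (∈-++⁺ʳ A (here refl))) })
    (λ |B₂|< → inc , short , All.universal (λ x → ≤-<-trans (length-filter (_<? x) B₂) |B₂|<) _)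

  -- S(P) with the permutation condition weakened to "distinct entries bounded by the length",
  -- which is all the argument uses.
  Avoider : List ℕ → Set
  Avoider α = Unique α × All (_≤ length α) α × Avoids P α

  inS⇒avoider : ∀ {n α} → InS P n α → length α ≡ n × Avoider α
  inS⇒avoider {n} {α} (α↭ , avoids) =
    |α|≡n , Unique-resp-↭ (↭⇒↭ₛ (↭.↭-sym α↭)) (AllPairs.map <⇒≢ (range-increasing n)) ,
    subst (λ l → All (_≤ l) α) (sym |α|≡n) (All-resp-↭ (↭.↭-sym α↭) (range-bounded n)) , avoids
    where
    |α|≡n : length α ≡ n
    |α|≡n = trans (↭-length α↭) (length-range n)

  avoider-insert : ∀ {α} A B → α ≡ A ++ B → Avoider α → Admissible A B → Avoider (A ++ suc (length α) ∷ B)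
  avoider-insert A B refl (uα , α≤ , avoids) adm =
    Unique-resp-↭ (↭⇒↭ₛ (↭.↭-sym (shift N A B))) (All.map (λ x≤ N≡x → 1+n≰n (subst (_≤ _) (sym N≡x) x≤)) α≤ ∷ uα) ,
    subst (λ l → All (_≤ l) (A ++ N ∷ B)) (sym (length-++-sucʳ A N B))
      (All.++⁺ (All.map m≤n⇒m≤1+n (All.++⁻ˡ A α≤)) (≤-refl ∷ All.map m≤n⇒m≤1+n (All.++⁻ʳ A α≤))) ,
    admissible⇒avoids A B avoids (All.map s≤s α≤) adm
    where N = suc (length (A ++ B))

  active⇔admissible : ∀ {α A B j} → Avoider α → α ≡ A ++ B → length B ≡ j → Active P α (suc j) ⇔ Admissible A B
  active⇔admissible {A = A} {B} (uα , α≤ , avoids) refl refl = mk⇔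
    (λ { (_ , _ , avoids′) →
         avoids⇒admissible A B (subst (Avoids P) (ins-++ A B) avoids′) (All.map s≤s α≤) (AllPairs-resp-⊆ (⊆-++⁺ˡ A ⊆-refl) uα) })
    (λ adm → s≤s z≤n , s≤s (length-mono-≤ (⊆-++⁺ˡ A ⊆-refl)) ,
             subst (Avoids P) (sym (ins-++ A B)) (admissible⇒avoids A B avoids (All.map s≤s α≤) adm))

  active-bound : ∀ {α j} → Active P α (suc j) → j ≤ length α
  active-bound (_ , s≤s j≤ , _) = j≤

  active? : ∀ {α} → Avoider α → ∀ j → Dec (Active P α (suc j))
  active? {α} av j with j ≤? length α
  ... | no  j≰ = no (j≰ ∘ active-bound)
  ... | yes j≤ with suffixOfLength α j j≤
  ...   | A , B , α≡ , |B|≡ = Dec.map (⇔.sym (active⇔admissible av α≡ |B|≡)) (admissible? A B)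

  active-site1 : ∀ {α} → Avoider α → Active P α 1
  active-site1 {α} av = from (active⇔admissible av (sym (++-identityʳ α)) refl) (admissible-[] α)

  active-pred : ∀ {α} → Avoider α → ∀ j → Active P α (suc (suc j)) → Active P α (suc j)
  active-pred {α} av j act with suffixOfLength α (suc j) (active-bound act)
  ... | A , y ∷ B , refl , refl =
    from (active⇔admissible av (sym (++-assoc A [ y ] B)) refl) (admissible-shift A y B (to (active⇔admissible {A = A} av refl refl) act))

  active⇒<m : ∀ {α j} → Avoider α → Active P α (suc j) → j < m
  active⇒<m {α} {j} av act with suffixOfLength α j (active-bound act)
  ... | A , B , refl , refl = proj₁ (proj₂ (to (active⇔admissible {A = A} av refl refl) act))

  activeUpTo : ∀ {α} → Avoider α → ∃ λ K → K ≤ m × ActiveUpTo P α K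
  activeUpTo {α} av with ↓-closed⇒initialSegment (active? av) (active-pred av) (suc (length α)) (λ _ → s≤s ∘ active-bound)
  ... | K , act = K , K≤m K act , act
    where
    K≤m : ∀ K → ActiveUpTo P α K → K ≤ m
    K≤m zero    _   = z≤n
    K≤m (suc K) act = active⇒<m av (from (act K) ≤-refl)

  avoider-∷ʳ : ∀ {α} → Avoider α → Avoider (α ++ [ suc (length α) ])
  avoider-∷ʳ {α} av = avoider-insert α [] (sym (++-identityʳ α)) av (admissible-[] α)

  active-∷ʳ : ∀ {α} → Avoider α → ∀ j →
    Active P (α ++ [ suc (length α) ]) (suc (suc j)) ⇔ (Active P α (suc j) × suc j < m)
  active-∷ʳ {α} av j with j ≤? length α
  ... | no  j≰ = ⇔-⊥ (j≰ ∘ ≤-pred ∘ subst (suc j ≤_) (length-∷ʳ α _) ∘ active-bound) (j≰ ∘ active-bound ∘ proj₁)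
  ... | yes j≤ with suffixOfLength α j j≤
  ...   | A , C , refl , refl =
    ⇔.trans (active⇔admissible (avoider-∷ʳ av) (++-assoc A C [ N ]) (length-∷ʳ C N))
      (⇔.trans (admissible-∷ʳ A C (All.++⁻ˡ A <N) (All.++⁻ʳ A <N))
               (⇔.sym (active⇔admissible av refl refl) ×-⇔ ⇔.refl))
    where
    N = suc (length (A ++ C))
    <N = All.map s≤s (proj₁ (proj₂ av))

  activeUpTo-∷ʳ : ∀ {α K} → Avoider α → ActiveUpTo P α K → ActiveUpTo P (α ++ [ suc (length α) ]) (suc K ⊓ m)
  activeUpTo-∷ʳ av act zero    = ⇔-⊤ (active-site1 (avoider-∷ʳ av)) (⊓-glb z<s (<-≤-trans z<s 2≤m))
  activeUpTo-∷ʳ av act (suc j) = ⇔.trans (active-∷ʳ av j) (⇔.trans (⇔.trans (act j) s<s⇔ ×-⇔ ⇔.refl) (⇔.sym <-⊓⇔))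

  active-afterMax : ∀ A b B t → Avoider (A ++ b ∷ B) → Admissible A (b ∷ B) → t ≤ length (b ∷ B) →
    Active P (A ++ suc (length (A ++ b ∷ B)) ∷ b ∷ B) (suc t) ⇔ t < p ∸ 1
  active-afterMax A b B t av adm@(inc , short , _) t≤ with suffixOfLength (b ∷ B) t t≤
  ... | B₁ , B₂ , bB≡ , refl =
    ⇔.trans (active⇔admissible (avoider-insert A (b ∷ B) refl av adm) split refl)
      (admissible-afterMax A B₁ B₂ (AllPairs-resp-⊆ B₂⊆ inc) (≤-<-trans (length-mono-≤ B₂⊆) short)
        (All-resp-⊆ B₂⊆ (All.map s≤s (All.++⁻ʳ A (proj₁ (proj₂ av))))))
    where
    N = suc (length (A ++ b ∷ B))

    B₂⊆ : B₂ ⊆ b ∷ B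
    B₂⊆ = subst (B₂ ⊆_) (sym bB≡) (⊆-++⁺ˡ B₁ ⊆-refl)

    split : A ++ N ∷ b ∷ B ≡ (A ++ N ∷ B₁) ++ B₂
    split = trans (cong (λ bB → A ++ N ∷ bB) bB≡) (sym (++-assoc A (N ∷ B₁) B₂))

  inactive-beforeMax : ∀ A b B t → Avoider (A ++ b ∷ B) → Admissible A (b ∷ B) → length (b ∷ B) < t →
    ¬ Active P (A ++ suc (length (A ++ b ∷ B)) ∷ b ∷ B) (suc t)
  inactive-beforeMax A b B t av adm |bB|<t act =
    N∷bB-unordered (proj₁ (to (active⇔admissible av′ refl refl) (↓-closed⇒≤-closed (active-pred av′) |bB|<t act)))
    where
    av′ = avoider-insert A (b ∷ B) refl av adm

    N∷bB-unordered : ¬ AllPairs _<_ (suc (length (A ++ b ∷ B)) ∷ b ∷ B)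
    N∷bB-unordered ((N<b ∷ _) ∷ _) = <-asym N<b (s≤s (All.head (All.++⁻ʳ A (proj₁ (proj₂ av)))))

  activeUpTo-insert : ∀ A b B → Avoider (A ++ b ∷ B) → Admissible A (b ∷ B) →
    ActiveUpTo P (A ++ suc (length (A ++ b ∷ B)) ∷ b ∷ B) (suc (length (b ∷ B)) ⊓ (p ∸ 1))
  activeUpTo-insert A b B av adm t with t ≤? length (b ∷ B)
  ... | yes t≤ = ⇔.trans (active-afterMax A b B t av adm t≤) (mk⇔ (⊓-glb (s≤s t≤)) (m<n⊓o⇒m<o _ _))
  ... | no  t≰ = ⇔-⊥ (inactive-beforeMax A b B t av adm (≰⇒> t≰)) (t≰ ∘ ≤-pred ∘ m<n⊓o⇒m<n _ _)

  chi-site1 : ∀ {K} → K ≤ m → chi p m 1 K ≡ suc K ⊓ m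
  chi-site1 {K} K≤m with K <ᵇ m | <ᵇ-reflects-< K m
  ... | true  | ofʸ K<m = sym (m≤n⇒m⊓n≡m K<m)
  ... | false | ofⁿ K≮m with ≤∧≮⇒≡ K≤m K≮m
  ...   | refl with K ≡ᵇ K | ≡⇒≡ᵇ K K refl
  ...     | true | _ = sym (m≥n⇒m⊓n≡n (n≤1+n K))

  chi-later : ∀ l K → chi p m (2 + l) K ≡ (2 + l) ⊓ (p ∸ 1)
  chi-later l K with 2 + l <ᵇ p | <ᵇ-reflects-< (2 + l) p
  ... | true  | ofʸ 2+l<p = sym (m≤n⇒m⊓n≡m (∸-monoˡ-≤ 1 2+l<p))
  ... | false | ofⁿ 2+l≮p = sym (m≥n⇒m⊓n≡n (m≤n⇒m≤1+n (∸-monoˡ-≤ 1 (≮⇒≥ 2+l≮p))))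

  activeUpTo-ins : ∀ {α K i} → Avoider α → K ≤ m → ActiveUpTo P α K → 1 ≤ i → i ≤ K →
    ActiveUpTo P (ins α i) (chi p m i K)
  activeUpTo-ins {α} {K} {1} av K≤m act _ _
    rewrite ins-site1 α | chi-site1 K≤m = activeUpTo-∷ʳ av act
  activeUpTo-ins {α} {K} {suc (suc l)} av K≤m act _ i≤K
    with suffixOfLength α (suc l) (active-bound (from (act (suc l)) i≤K))
  ... | A , b ∷ B , refl , refl rewrite ins-++ A (b ∷ B) | chi-later (length B) K =
    activeUpTo-insert A b B av (to (active⇔admissible av refl refl) (from (act (suc l)) i≤K))

  succession : ∀ {α k i} → Avoider α → NumActive P α k → 1 ≤ i → i ≤ k → NumActive P (ins α i) (chi p m i k)
  succession av numα 1≤i i≤k with activeUpTo av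
  ... | K , K≤m , act with numActive-unique numα (activeUpTo⇒numActive act)
  ... | refl = activeUpTo⇒numActive (activeUpTo-ins av K≤m act 1≤i i≤k)

  avoids-swapMax : ∀ {N} A y B → Avoids P (A ++ N ∷ y ∷ B) → All (_< N) (A ++ y ∷ B) → Unique (y ∷ B) →
    Avoids P (A ++ y ∷ N ∷ B)
  avoids-swapMax {N} A y B avoids <N uyB =
    subst (Avoids P) (++-assoc A [ y ] (N ∷ B))
      (admissible⇒avoids (A ++ [ y ]) B (subst (Avoids P) Ay-B (Avoids-resp-⊆ (⊆-++⁺ ⊆-refl (N ∷ʳ ⊆-refl)) avoids))
        (subst (All (_< N)) Ay-B <N) (admissible-shift A y B (avoids⇒admissible A (y ∷ B) avoids <N uyB)))
    where
    Ay-B : A ++ y ∷ B ≡ (A ++ [ y ]) ++ B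
    Ay-B = sym (++-assoc A [ y ] B)

  rightJustified : RightJustified P
  rightJustified n α k α∈S α[k]≡n 1+k<n with inS⇒avoider α∈S
  ... | |α|≡n , uα , α≤ , avoids with swapAt-decomposition α k (subst (suc k <_) (sym |α|≡n) 1+k<n)
  ... | A , B , z , y , refl , α[k]≡z , swap≡ with trans (sym α[k]≡z) α[k]≡n
  ... | refl rewrite swap≡ =
    ↭.↭-trans (++⁺ˡ A (↭.swap y n ↭.↭-refl)) (proj₁ α∈S) ,
    avoids-swapMax A y B avoids others<n (AllPairs-resp-⊆ (⊆-++⁺ˡ A (n ∷ʳ ⊆-refl)) uα)
    where
    others<n : All (_< n) (A ++ y ∷ B)
    others<n = unique-max⇒others< A (y ∷ B) uα (subst (λ l → All (_≤ l) (A ++ n ∷ y ∷ B)) |α|≡n α≤)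

theorem2 : (p m : ℕ) → 2 ≤ p → 2 ≤ m →
    Regular (patterns p m) × IsRegularWith (patterns p m) (chi p m)
theorem2 p m 2≤p 2≤m = (chi p m , regular) , regular
  where
  open Regularity p m 2≤p 2≤m

  regular : IsRegularWith (patterns p m) (chi p m)
  regular = rightJustified
          , (λ n α α∈S → active-site1 (proj₂ (inS⇒avoider α∈S)))
          , (λ n α k i α∈S numα → succession (proj₂ (inS⇒avoider α∈S)) numα)
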